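{- Let $\mathcal{C}=(C,\chi,W,\ell)$ and $\mathcal{C}'=(C',\chi',W',\ell')$ be polychromatic models, let $f$ be a morphism from $\mathcal{C}$ to $\mathcal{C}'$, and let $\psi$ be a positive formula. Then for all $X\in W$, \[ \mathcal{C}',f(X)\Vdash\psi\quad\text{implies}\quad\mathcal{C},X\Vdash\psi . \]
   Context: A simplicial complex is a pair $C=(S,\mathcal{V})$ with $S\subseteq\mathcal{P}(\mathcal{V})\setminus\{\emptyset\}$ closed under nonempty subsets; $\mathcal{F}(C)$ is its set of inclusion-maximal elements. Fix a finite set of agents $\mathsf{Ag}$ and a countable set $\mathsf{Prop}$ of atomic propositions. A polychromatic model is $\mathcal{C}=(C,\chi,W,\ell)$ with $C=(S,\mathcal{V})$ a simplicial complex, $\chi:\mathcal{V}\to\mathsf{Ag}$ an arbitrary coloring, $\mathcal{F}(C)\subseteq W\subseteq S$, $\ell:W\to\mathcal{P}(\mathsf{Prop})$, satisfying: for all $X,Y,Z\in W$ and $G\subseteq\mathsf{Ag}$, $G\subseteq\chi(X\cap Y)$ and $G\subseteq\chi(Y\cap Z)$ imply $G\subseteq\chi(X\cap Z)$, where $\chi(U)=\{\chi(u)\mid u\in U\}$. In $\mathcal{C}$, $X\sim_G Y$ iff $G\subseteq\chi(X\cap Y)$. A simplicial map from $C=(S,\mathcal{V})$ to $C'=(S',\mathcal{V}')$ is $f:\mathcal{V}\to\mathcal{V}'$ with $f(X)=\{f(x)\mid x\in X\}\in S'$ for all $X\in S$. A morphism from $\mathcal{C}$ to $\mathcal{C}'$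 is a simplicial map $f$ from $C$ to $C'$ with $\chi'(f(v))=\chi(v)$ for all $v\in\mathcal{V}$, $f(X)\in W'$ and $\ell'(f(X))=\ell(X)$ for all $X\in W$. Positive formulas are generated by: $\phi::=p\mid\neg\phi\mid\phi\wedge\phi$ and $\psi::=\phi\mid\psi\wedge\psi\mid\psi\vee\psi\mid[\sim]_G\psi$ ($p\in\mathsf{Prop}$, $G\subseteq\mathsf{Ag}$); formulas of type $\psi$ are positive. Truth: $\mathcal{C},X\Vdash p$ iff $p\in\ell(X)$; $\neg,\wedge,\vee$ classical; $\mathcal{C},X\Vdash[\sim]_G\psi$ iff $\mathcal{C},Y\Vdash\psi$ for all $Y\in W$ with $X\sim_G Y$. -}

module Defs where

open import Level using (0ℓ)
open import Data.Nat using (ℕ)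
open import Data.Fin using (Fin)
open import Data.Fin.Subset using (Subset) renaming (_∈_ to _∈ₛ_)
open import Data.Product using (Σ; ∃; _×_; _,_)
open import Data.Sum using (_⊎_)
open import Data.Empty using (⊥)
open import Relation.Nullary using (¬_)
open import Relation.Unary using (Pred; _∈_; _⊆_; _∩_; _≐_; Satisfiable)
open import Relation.Binary.PropositionalEquality using (_≡_)

VSet : Set → Set₁
VSet V = Pred V 0ℓ

image : {V V′ : Set} → (V → V′) → VSet V → VSet V′
image f X y = ∃ λ x → x ∈ X × f x ≡ y

record SimplicialComplex (V : Set) : Set₂ where
  field
    S         : Pred (VSet V) 0ℓ
    nonempty  : ∀ X → X ∈ S → Satisfiable X
    downClosed : ∀ X Y → X ∈ S → Satisfiable Y → Y ⊆ X → Y ∈ S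

Facet : {V : Set} → SimplicialComplex V → VSet V → Set₁
Facet C X = X ∈ SimplicialComplex.S C
          × (∀ Y → Y ∈ SimplicialComplex.S C → X ⊆ Y → Y ⊆ X)

-- G ⊆ χ(U), where χ(U) = { χ u | u ∈ U }; agents Ag = Fin k.
_⊆χ[_]_ : {k : ℕ} {V : Set} → Subset k → (V → Fin k) → VSet V → Set
G ⊆χ[ χ ] U = ∀ a → a ∈ₛ G → ∃ λ u → u ∈ U × χ u ≡ a

-- Atomic propositions Prop = ℕ; labels are subsets of Prop.
record PolyModel (k : ℕ) : Set₂ where
  field
    V     : Set
    C     : SimplicialComplex V
    χ     : V → Fin k
    W     : Pred (VSet V) 0ℓ
    facets⊆W : ∀ X → Facet C X → X ∈ W
    W⊆S   : ∀ X → X ∈ W → X ∈ SimplicialComplex.S C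
    ℓ     : VSet V → Pred ℕ 0ℓ   -- only its values on W matter
    trans : ∀ X Y Z (G : Subset k) → X ∈ W → Y ∈ W → Z ∈ W →
            G ⊆χ[ χ ] (X ∩ Y) → G ⊆χ[ χ ] (Y ∩ Z) → G ⊆χ[ χ ] (X ∩ Z)

  _∼[_]_ : VSet V → Subset k → VSet V → Set
  X ∼[ G ] Y = G ⊆χ[ χ ] (X ∩ Y)

open PolyModel

record Morphism {k : ℕ} (M M′ : PolyModel k) : Set₁ where
  field
    f          : V M → V M′
    simplicial : ∀ X → X ∈ SimplicialComplex.S (C M) →
                 image f X ∈ SimplicialComplex.S (C M′)
    colour     : ∀ v → χ M′ (f v) ≡ χ M v
    preservesW : ∀ X → X ∈ W M → image f X ∈ W M′
    preservesℓ : ∀ X → X ∈ W M → ℓ M′ (image f X) ≐ ℓ M X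

data Lit : Set where
  atom : ℕ → Lit
  neg  : Lit → Lit
  conj : Lit → Lit → Lit

data PosFormula (k : ℕ) : Set where
  lit  : Lit → PosFormula k
  and  : PosFormula k → PosFormula k → PosFormula k
  or   : PosFormula k → PosFormula k → PosFormula k
  box  : Subset k → PosFormula k → PosFormula k

_,_⊩ˡ_ : {k : ℕ} (M : PolyModel k) → VSet (V M) → Lit → Set
M , X ⊩ˡ atom p   = p ∈ ℓ M X
M , X ⊩ˡ neg φ    = ¬ (M , X ⊩ˡ φ)
M , X ⊩ˡ conj φ χ = (M , X ⊩ˡ φ) × (M , X ⊩ˡ χ)

_,_⊩_ : {k : ℕ} (M : PolyModel k) → VSet (V M) → PosFormula k → Set₁
M , X ⊩ lit φ   = Level.Lift _ (M , X ⊩ˡ φ)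
M , X ⊩ and ψ θ = (M , X ⊩ ψ) × (M , X ⊩ θ)
M , X ⊩ or ψ θ  = (M , X ⊩ ψ) ⊎ (M , X ⊩ θ)
M , X ⊩ box G ψ = ∀ Y → Y ∈ W M → _∼[_]_ M X G Y → M , Y ⊩ ψ

{-# OPTIONS --safe #-}
module Submission where

open import Defs
open import Data.Nat using (ℕ)
open import Data.Fin using (Fin)
open import Data.Product using (_,_; proj₁; proj₂)
open import Data.Product.Function.NonDependent.Propositional using (_×-⇔_)
open import Data.Sum using (inj₁; inj₂)
open import Function.Bundles using (_⇔_; mk⇔; Equivalence)
open import Function.Related.TypeIsomorphisms using (¬-cong-⇔)
open import Level using (lift)
open import Relation.Binary.PropositionalEquality using (_≡_; refl; trans)
open import Relation.Unary using (_∈_; _∩_; _≐_)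

-- Literals only see the label, which f preserves, so they hold at
-- f(X) exactly when they hold at X; both directions are needed because of
-- negation. A colour-preserving map sends G-neighbours Y of X to G-neighbours
-- f(Y) of f(X), so a box true at f(X) covers every f(Y), and by induction ψ then
-- holds at every such Y.

⊩ˡ-cong-ℓ : {k : ℕ} {M M′ : PolyModel k} {X : VSet (PolyModel.V M)} {X′ : VSet (PolyModel.V M′)} →
            PolyModel.ℓ M′ X′ ≐ PolyModel.ℓ M X →
            ∀ φ → (M′ , X′ ⊩ˡ φ) ⇔ (M , X ⊩ˡ φ)
⊩ˡ-cong-ℓ ℓ≐ (atom p)   = mk⇔ (proj₁ ℓ≐) (proj₂ ℓ≐)
⊩ˡ-cong-ℓ ℓ≐ (neg φ)    = ¬-cong-⇔ (⊩ˡ-cong-ℓ ℓ≐ φ)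
⊩ˡ-cong-ℓ ℓ≐ (conj φ θ) = ⊩ˡ-cong-ℓ ℓ≐ φ ×-⇔ ⊩ˡ-cong-ℓ ℓ≐ θ

⊆χ-∩-image : {k : ℕ} {V V′ : Set} {χ : V → Fin k} {χ′ : V′ → Fin k} (f : V → V′) →
             (∀ v → χ′ (f v) ≡ χ v) →
             ∀ {G X Y} → G ⊆χ[ χ ] (X ∩ Y) → G ⊆χ[ χ′ ] (image f X ∩ image f Y)
⊆χ-∩-image f colour G⊆χX∩Y a a∈G with G⊆χX∩Y a a∈G
... | u , (u∈X , u∈Y) , χu≡a = f u , ((u , u∈X , refl) , (u , u∈Y , refl)) , trans (colour u) χu≡a

open Morphism

mainTheorem7 : {k : ℕ} (M M′ : PolyModel k) (m : Morphism M M′) (ψ : PosFormula k) →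
    ∀ X → X ∈ PolyModel.W M →
    M′ , image (Morphism.f m) X ⊩ ψ → M , X ⊩ ψ
mainTheorem7 M M′ m (lit φ) X X∈W (lift h) =
  lift (Equivalence.to (⊩ˡ-cong-ℓ (preservesℓ m X X∈W) φ) h)
mainTheorem7 M M′ m (and ψ θ) X X∈W (hψ , hθ) =
  mainTheorem7 M M′ m ψ X X∈W hψ , mainTheorem7 M M′ m θ X X∈W hθ
mainTheorem7 M M′ m (or ψ θ) X X∈W (inj₁ hψ) = inj₁ (mainTheorem7 M M′ m ψ X X∈W hψ)
mainTheorem7 M M′ m (or ψ θ) X X∈W (inj₂ hθ) = inj₂ (mainTheorem7 M M′ m θ X X∈W hθ)
mainTheorem7 M M′ m (box G ψ) X X∈W h Y Y∈W X∼Y =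
  mainTheorem7 M M′ m ψ Y Y∈W
    (h (image (f m) Y) (preservesW m Y Y∈W) (⊆χ-∩-image (f m) (colour m) X∼Y))
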